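{- Let $\varphi=C_1\wedge\cdots\wedge C_m$ be a CNF formula over the Boolean variables $z_1,\ldots,z_k$, with literal set $Z=\{z_1,\bar z_1,\ldots,z_k,\bar z_k\}$. Each clause $C_i$ is a set of at most three literals from $Z$. Then $\varphi$ has a truth assignment in which every clause contains exactly one true literal if and only if the following system has a solution in $0,1$-variables $x_j,\bar x_j$ ($j=1,\ldots,k$) and $x_{ij},\bar x_{ij}$ ($i=1,\ldots,m$, $j=1,\ldots,k$): 1. $x_j+\bar x_j=1$ for $j=1,\ldots,k$; 2. $\sum_{j=1}^k x_{ij}+\sum_{j=1}^k \bar x_{ij}=1$ for $i=1,\ldots,m$; 3. $x_j\ge x_{ij}$ and $\bar x_j\ge \bar x_{ij}$ for all $i=1,\ldots,m$ and $j=1,\ldots,k$; 4. $\sum_{j:\,z_j\in C_i} x_{ij}+\sum_{j:\,\bar z_j\in C_i}\bar x_{ij}\ge 1$ for $i=1,\ldots,m$; 5. $x_{ij}\ge x_j$ for all $i,j$ with $z_j\in C_i$; 6. $\bar x_{ij}\ge \bar x_j$ for all $i,j$ with $\bar z_j\in C_i$.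
   Context: In the system, the variable $x_j$ (respectively $\bar x_j$) represents the literal $z_j$ (respectively $\bar z_j$) being true. The intended meaning of $x_{ij}=1$ (respectively $\bar x_{ij}=1$) is that the literal $z_j$ (respectively $\bar z_j$) appears in clause $C_i$ and is true. -}

module Defs where

open import Data.Nat using (ℕ; zero; suc; _+_; _≤_)
open import Data.Fin using (Fin)
open import Data.Fin.Properties using () renaming (_≟_ to _≟ᶠ_)
open import Data.Bool using (Bool; true; false)
open import Data.List using (List; length; filter)
open import Data.List.Relation.Unary.Unique.Propositional using (Unique)
open import Data.List.Membership.Propositional using (_∈_)
open import Data.List.Membership.DecPropositional using () renaming (_∈?_ to ∈?-gen)
open import Data.Vec using (Vec; lookup)
open import Data.Product using (_×_; Σ; ∃)
open import Relation.Binary.PropositionalEquality using (_≡_; refl)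
open import Relation.Binary.Definitions using (DecidableEquality)
open import Relation.Nullary using (Dec; yes; no; does)

-- Literals over variables z_0 … z_{k-1}: pos j is z_j, neg j is z̄_j.
data Literal (k : ℕ) : Set where
  pos : Fin k → Literal k
  neg : Fin k → Literal k

_≟ℓ_ : ∀ {k} → DecidableEquality (Literal k)
pos a ≟ℓ pos b with a ≟ᶠ b
... | yes refl = yes refl
... | no ¬p = no λ { refl → ¬p refl }
pos a ≟ℓ neg b = no λ ()
neg a ≟ℓ pos b = no λ ()
neg a ≟ℓ neg b with a ≟ᶠ b
... | yes refl = yes refl
... | no ¬p = no λ { refl → ¬p refl }

_∈?_ : ∀ {k} (l : Literal k) (C : List (Literal k)) → Dec (l ∈ C)
_∈?_ = ∈?-gen _≟ℓ_

record Clause (k : ℕ) : Set where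
  field
    lits   : List (Literal k)
    unique : Unique lits
    small  : length lits ≤ 3
open Clause public

CNF : ℕ → ℕ → Set
CNF k m = Vec (Clause k) m

Assignment : ℕ → Set
Assignment k = Fin k → Bool

litVal : ∀ {k} → Assignment k → Literal k → Bool
litVal σ (pos j) = σ j
litVal σ (neg j) with σ j
... | true = false
... | false = true

IsTrue : Bool → Set
IsTrue b = b ≡ true

trueCount : ∀ {k} → Assignment k → Clause k → ℕ
trueCount σ C = length (filter (λ l → Data.Bool._≟_ (litVal σ l) true) (lits C))

ExactlyOneSat : ∀ {k m} → CNF k m → Assignment k → Set
ExactlyOneSat {k} {m} φ σ = (i : Fin m) → trueCount σ (lookup φ i) ≡ 1

sumFin : ∀ {n} → (Fin n → ℕ) → ℕ
sumFin {zero} f = 0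
sumFin {suc n} f = f Data.Fin.zero + sumFin (λ j → f (Data.Fin.suc j))

ifIn : ∀ {k} → Literal k → Clause k → ℕ → ℕ
ifIn l C x with l ∈? lits C
... | yes _ = x
... | no _ = 0

Binary : ℕ → Set
Binary x = x ≤ 1

-- The 0/1 system of the proposition.
-- x xb : Fin k → ℕ  are x_j, x̄_j;  y yb : Fin m → Fin k → ℕ  are x_ij, x̄_ij.
System : ∀ {k m} → CNF k m →
         (Fin k → ℕ) → (Fin k → ℕ) → (Fin m → Fin k → ℕ) → (Fin m → Fin k → ℕ) → Set
System {k} {m} φ x xb y yb =
  ((j : Fin k) → Binary (x j) × Binary (xb j)) ×
  ((i : Fin m) (j : Fin k) → Binary (y i j) × Binary (yb i j)) ×
  ((j : Fin k) → x j + xb j ≡ 1) ×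
  ((i : Fin m) → sumFin (y i) + sumFin (yb i) ≡ 1) ×
  ((i : Fin m) (j : Fin k) → y i j ≤ x j × yb i j ≤ xb j) ×
  ((i : Fin m) → 1 ≤ sumFin (λ j → ifIn (pos j) (lookup φ i) (y i j))
                   + sumFin (λ j → ifIn (neg j) (lookup φ i) (yb i j))) ×
  ((i : Fin m) (j : Fin k) → pos j ∈ lits (lookup φ i) → x j ≤ y i j) ×
  ((i : Fin m) (j : Fin k) → neg j ∈ lits (lookup φ i) → xb j ≤ yb i j)

{-# OPTIONS --safe #-}
-- A clause C is a duplicate-free list of literals, so for any weights w on literals the
-- restricted sum  Σ_{z_j ∈ C} w(z_j) + Σ_{z̄_j ∈ C} w(z̄_j)  equals the sum of w along C, and
-- for the 0/1 truth values of an assignment it counts the true literals of C.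
-- Forward: take x_j the truth value of z_j and x_ij the restriction of x_j to the literals
-- of C_i; conditions 2 and 4 then both say that C_i has exactly one true literal.
-- Backward: conditions 3, 5 and 6 force x_ij = x_j on the literals of C_i, so the number of
-- true literals of C_i is the sum in condition 4, which is at least 1 and at most the sum
-- in condition 2, which is 1.
module Submission where

open import Defs
open import Data.Bool using (Bool; true; false; not; _≟_)
open import Data.Fin as Fin using (Fin)
open import Data.List using (List; []; _∷_; _++_; map; filter; length; tabulate; allFin)
open import Data.List.Properties using (map-++; map-∘; map-tabulate; map-cong-local)
import Data.List.Membership.DecPropositional as DecMembership
open import Data.List.Membership.Propositional using (_∈_)
open import Data.List.Membership.Propositional.Properties
  using (∈-map⁺; ∈-map⁻; ∈-++⁺ˡ; ∈-++⁺ʳ; ∈-filter⁺; ∈-filter⁻; ∈-allFin)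
open import Data.List.Membership.Propositional.Properties.WithK using (unique∧set⇒bag)
open import Data.List.Relation.Binary.BagAndSetEquality using (∼bag⇒↭)
open import Data.List.Relation.Binary.Disjoint.Propositional using (Disjoint)
open import Data.List.Relation.Binary.Permutation.Propositional using (_↭_)
import Data.List.Relation.Binary.Permutation.Propositional.Properties as ↭
open import Data.List.Relation.Binary.Subset.Propositional using (_⊆_)
import Data.List.Relation.Unary.All as All
open import Data.List.Relation.Unary.Unique.Propositional using (Unique)
import Data.List.Relation.Unary.Unique.Propositional.Properties as Unique
open import Data.Nat using (ℕ; zero; suc; _+_; _≤_; z≤n; _≡ᵇ_)
open import Data.Nat.ListAction using (sum)
open import Data.Nat.ListAction.Properties using (sum-++; sum-↭)
open import Data.Nat.Properties using (≤-refl; ≤-reflexive; ≤-trans; ≤-antisym; +-mono-≤)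
open import Data.Product using (Σ; ∃; _×_; _,_; proj₁; proj₂)
open import Data.Vec using (lookup)
open import Function using (id; _∘_; _⇔_; mk⇔)
open import Level using (Level)
open import Relation.Binary.Definitions using (DecidableEquality)
open import Relation.Binary.PropositionalEquality
open import Relation.Nullary using (yes; no; ¬_)
open import Relation.Unary using (Pred; Decidable)

private
  variable
    a p : Level
    A : Set a
    k m : ℕ

indicator : Bool → ℕ
indicator true = 1
indicator false = 0

indicator≤1 : ∀ b → indicator b ≤ 1
indicator≤1 true = ≤-refl
indicator≤1 false = z≤n

length-filter≡sum-indicator : (f : A → Bool) (xs : List A) →
  length (filter (λ x → f x ≟ true) xs) ≡ sum (map (indicator ∘ f) xs)
length-filter≡sum-indicator f [] = refl
length-filter≡sum-indicator f (x ∷ xs) with f x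
... | true = cong suc (length-filter≡sum-indicator f xs)
... | false = length-filter≡sum-indicator f xs

sum-map-filter : {P : Pred A p} (P? : Decidable P) (f g : A → ℕ) →
  (∀ x → P x → g x ≡ f x) → (∀ x → ¬ P x → g x ≡ 0) →
  ∀ xs → sum (map f (filter P? xs)) ≡ sum (map g xs)
sum-map-filter P? f g accept reject [] = refl
sum-map-filter P? f g accept reject (x ∷ xs) with P? x
... | yes px = cong₂ _+_ (sym (accept x px)) (sum-map-filter P? f g accept reject xs)
... | no ¬px = cong₂ _+_ (sym (reject x ¬px)) (sum-map-filter P? f g accept reject xs)

module _ (_≟ᴬ_ : DecidableEquality A) where
  open DecMembership _≟ᴬ_ using () renaming (_∈?_ to _∈ᴬ?_)

  filter-∈-↭ : ∀ {xs ys} → Unique xs → Unique ys → ys ⊆ xs → filter (_∈ᴬ? ys) xs ↭ ys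
  filter-∈-↭ {xs} {ys} xs-unique ys-unique ys⊆xs =
    ∼bag⇒↭ (unique∧set⇒bag (Unique.filter⁺ (_∈ᴬ? ys) xs-unique) ys-unique
      (mk⇔ (proj₂ ∘ ∈-filter⁻ (_∈ᴬ? ys) {xs = xs})
           (λ v∈ys → ∈-filter⁺ (_∈ᴬ? ys) (ys⊆xs v∈ys) v∈ys)))

sumFin≡sum-allFin : ∀ {n} (f : Fin n → ℕ) → sumFin f ≡ sum (map f (allFin n))
sumFin≡sum-allFin f = trans (sumFin≡sum-tabulate f) (cong sum (sym (map-tabulate id f)))
  where
  sumFin≡sum-tabulate : ∀ {n} (f : Fin n → ℕ) → sumFin f ≡ sum (tabulate f)
  sumFin≡sum-tabulate {zero} f = refl
  sumFin≡sum-tabulate {suc n} f = cong (f Fin.zero +_) (sumFin≡sum-tabulate (f ∘ Fin.suc))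

sumFin-mono : ∀ {n} {f g : Fin n → ℕ} → (∀ j → f j ≤ g j) → sumFin f ≤ sumFin g
sumFin-mono {zero} f≤g = z≤n
sumFin-mono {suc n} f≤g = +-mono-≤ (f≤g Fin.zero) (sumFin-mono (f≤g ∘ Fin.suc))

allLiterals : ∀ k → List (Literal k)
allLiterals k = map pos (allFin k) ++ map neg (allFin k)

∈-allLiterals : (l : Literal k) → l ∈ allLiterals k
∈-allLiterals (pos j) = ∈-++⁺ˡ (∈-map⁺ pos (∈-allFin j))
∈-allLiterals {k} (neg j) = ∈-++⁺ʳ (map pos (allFin k)) (∈-map⁺ neg (∈-allFin j))

allLiterals-unique : ∀ k → Unique (allLiterals k)
allLiterals-unique k = Unique.++⁺
  (Unique.map⁺ (λ { refl → refl }) (Unique.allFin⁺ k))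
  (Unique.map⁺ (λ { refl → refl }) (Unique.allFin⁺ k))
  pos-neg-disjoint
  where
  pos-neg-disjoint : Disjoint (map pos (allFin k)) (map neg (allFin k))
  pos-neg-disjoint (l∈pos , l∈neg) with ∈-map⁻ pos l∈pos | ∈-map⁻ neg l∈neg
  ... | _ , _ , refl | _ , _ , ()

litSum : (Literal k → ℕ) → ℕ
litSum w = sumFin (w ∘ pos) + sumFin (w ∘ neg)

litSum≡sum-allLiterals : (w : Literal k → ℕ) → litSum w ≡ sum (map w (allLiterals k))
litSum≡sum-allLiterals {k} w = begin
  sumFin (w ∘ pos) + sumFin (w ∘ neg)
    ≡⟨ cong₂ _+_ (sumFin≡sum-allFin (w ∘ pos)) (sumFin≡sum-allFin (w ∘ neg)) ⟩
  sum (map (w ∘ pos) (allFin k)) + sum (map (w ∘ neg) (allFin k))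
    ≡⟨ cong₂ _+_ (cong sum (map-∘ (allFin k))) (cong sum (map-∘ (allFin k))) ⟩
  sum (map w (map pos (allFin k))) + sum (map w (map neg (allFin k)))
    ≡⟨ sym (sum-++ (map w (map pos (allFin k))) _) ⟩
  sum (map w (map pos (allFin k)) ++ map w (map neg (allFin k)))
    ≡⟨ cong sum (sym (map-++ w (map pos (allFin k)) _)) ⟩
  sum (map w (allLiterals k)) ∎
  where open ≡-Reasoning

ifIn-∈ : ∀ {l : Literal k} {C} {x} → l ∈ lits C → ifIn l C x ≡ x
ifIn-∈ {l = l} {C} l∈C with l ∈? lits C
... | yes _ = refl
... | no l∉C with () ← l∉C l∈C

ifIn-∉ : ∀ {l : Literal k} {C} {x} → ¬ l ∈ lits C → ifIn l C x ≡ 0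
ifIn-∉ {l = l} {C} l∉C with l ∈? lits C
... | yes l∈C with () ← l∉C l∈C
... | no _ = refl

ifIn-≤ : ∀ (l : Literal k) C x → ifIn l C x ≤ x
ifIn-≤ l C x with l ∈? lits C
... | yes _ = ≤-refl
... | no _ = z≤n

clauseSum : Clause k → (Literal k → ℕ) → ℕ
clauseSum C w = litSum (λ l → ifIn l C (w l))

clauseSum≡sum : (C : Clause k) (w : Literal k → ℕ) → clauseSum C w ≡ sum (map w (lits C))
clauseSum≡sum {k} C w = begin
  clauseSum C w
    ≡⟨ litSum≡sum-allLiterals (λ l → ifIn l C (w l)) ⟩
  sum (map (λ l → ifIn l C (w l)) (allLiterals k))
    ≡⟨ sym (sum-map-filter (_∈? lits C) w _ (λ _ → ifIn-∈) (λ _ → ifIn-∉) (allLiterals k)) ⟩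
  sum (map w (filter (_∈? lits C) (allLiterals k)))
    ≡⟨ sum-↭ (↭.map⁺ w (filter-∈-↭ _≟ℓ_ (allLiterals-unique k) (unique C) (λ {l} _ → ∈-allLiterals l))) ⟩
  sum (map w (lits C)) ∎
  where open ≡-Reasoning

clauseSum-cong : (C : Clause k) {w w′ : Literal k → ℕ} →
  (∀ l → l ∈ lits C → w l ≡ w′ l) → clauseSum C w ≡ clauseSum C w′
clauseSum-cong C {w} {w′} agree = begin
  clauseSum C w           ≡⟨ clauseSum≡sum C w ⟩
  sum (map w (lits C))    ≡⟨ cong sum (map-cong-local (All.tabulate (agree _))) ⟩
  sum (map w′ (lits C))   ≡⟨ sym (clauseSum≡sum C w′) ⟩
  clauseSum C w′          ∎
  where open ≡-Reasoning

clauseSum≤litSum : (C : Clause k) (w : Literal k → ℕ) → clauseSum C w ≤ litSum w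
clauseSum≤litSum C w =
  +-mono-≤ (sumFin-mono (λ j → ifIn-≤ (pos j) C _)) (sumFin-mono (λ j → ifIn-≤ (neg j) C _))

value : Assignment k → Literal k → ℕ
value σ = indicator ∘ litVal σ

trueCount≡clauseSum : (σ : Assignment k) (C : Clause k) → trueCount σ C ≡ clauseSum C (value σ)
trueCount≡clauseSum σ C =
  trans (length-filter≡sum-indicator (litVal σ) (lits C)) (sym (clauseSum≡sum C (value σ)))

value-complement : (σ : Assignment k) (j : Fin k) → value σ (pos j) + value σ (neg j) ≡ 1
value-complement σ j with σ j
... | true = refl
... | false = refl

litVal-neg : (σ : Assignment k) (j : Fin k) → litVal σ (neg j) ≡ not (σ j)
litVal-neg σ j with σ j
... | true = refl
... | false = refl

litWeight : (Fin k → ℕ) → (Fin k → ℕ) → Literal k → ℕ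
litWeight x xb (pos j) = x j
litWeight x xb (neg j) = xb j

exactlyOneSat⇒system : (φ : CNF k m) (σ : Assignment k) → ExactlyOneSat φ σ →
  System φ (λ j → value σ (pos j)) (λ j → value σ (neg j))
           (λ i j → ifIn (pos j) (lookup φ i) (value σ (pos j)))
           (λ i j → ifIn (neg j) (lookup φ i) (value σ (neg j)))
exactlyOneSat⇒system φ σ exactlyOne =
    (λ j → indicator≤1 _ , indicator≤1 _)
  , (λ i j → ≤-trans (ifIn-≤ (pos j) (lookup φ i) _) (indicator≤1 _)
           , ≤-trans (ifIn-≤ (neg j) (lookup φ i) _) (indicator≤1 _))
  , value-complement σ
  , (λ i → trans (sym (trueCount≡clauseSum σ (lookup φ i))) (exactlyOne i))
  , (λ i j → ifIn-≤ (pos j) (lookup φ i) _ , ifIn-≤ (neg j) (lookup φ i) _)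
  , (λ i → ≤-reflexive (sym (begin
      clauseSum (lookup φ i) (λ l → ifIn l (lookup φ i) (value σ l))
        ≡⟨ clauseSum-cong (lookup φ i) (λ l → ifIn-∈ {C = lookup φ i} {value σ l}) ⟩
      clauseSum (lookup φ i) (value σ)
        ≡⟨ sym (trueCount≡clauseSum σ (lookup φ i)) ⟩
      trueCount σ (lookup φ i)
        ≡⟨ exactlyOne i ⟩
      1 ∎)))
  , (λ i j z∈C → ≤-reflexive (sym (ifIn-∈ z∈C)))
  , (λ i j z̄∈C → ≤-reflexive (sym (ifIn-∈ z̄∈C)))
  where open ≡-Reasoning

complement-indicator : ∀ {x xb} → x + xb ≡ 1 → indicator (x ≡ᵇ 1) ≡ x × indicator (not (x ≡ᵇ 1)) ≡ xb
complement-indicator {zero} refl = refl , refl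
complement-indicator {suc zero} {zero} refl = refl , refl

system⇒exactlyOneSat : (φ : CNF k m) {x xb : Fin k → ℕ} {y yb : Fin m → Fin k → ℕ} →
  System φ x xb y yb → ExactlyOneSat φ (λ j → x j ≡ᵇ 1)
system⇒exactlyOneSat φ {x} {xb} {y} {yb}
    (_ , _ , complement , oneChosen , below , atLeastOne , posTight , negTight) i =
  trans trueCount≡weights (≤-antisym
    (≤-trans (clauseSum≤litSum C (litWeight (y i) (yb i))) (≤-reflexive (oneChosen i)))
    (atLeastOne i))
  where
  σ : Assignment _
  σ j = x j ≡ᵇ 1

  C : Clause _
  C = lookup φ i

  value≡litWeight : ∀ l → value σ l ≡ litWeight x xb l
  value≡litWeight (pos j) = proj₁ (complement-indicator (complement j))
  value≡litWeight (neg j) =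
    trans (cong indicator (litVal-neg σ j)) (proj₂ (complement-indicator (complement j)))

  litWeight-tight : ∀ l → l ∈ lits C → litWeight x xb l ≡ litWeight (y i) (yb i) l
  litWeight-tight (pos j) z∈C = ≤-antisym (posTight i j z∈C) (proj₁ (below i j))
  litWeight-tight (neg j) z̄∈C = ≤-antisym (negTight i j z̄∈C) (proj₂ (below i j))

  trueCount≡weights : trueCount σ C ≡ clauseSum C (litWeight (y i) (yb i))
  trueCount≡weights = trans (trueCount≡clauseSum σ C)
    (clauseSum-cong C (λ l l∈C → trans (value≡litWeight l) (litWeight-tight l l∈C)))

proposition3p2 : (k m : ℕ) (φ : CNF k m) →
    (∃ λ (σ : Assignment k) → ExactlyOneSat φ σ) ⇔
    (Σ (Fin k → ℕ) λ x → Σ (Fin k → ℕ) λ xb →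
       Σ (Fin m → Fin k → ℕ) λ y → Σ (Fin m → Fin k → ℕ) λ yb →
         System φ x xb y yb)
proposition3p2 k m φ = mk⇔
  (λ (σ , exactlyOne) → _ , _ , _ , _ , exactlyOneSat⇒system φ σ exactlyOne)
  (λ (_ , _ , _ , _ , solution) → _ , system⇒exactlyOneSat φ solution)
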